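{- Let $k$ be a nonnegative integer, let $G=(V,E)$ be a graph and let $X\subseteq V$ be such that $G[X]$ is connected and $\deg_G(x)\leq k+1$ for every $x\in X$. Let $u$ be an arbitrary vertex in $X$. Then $\{u\}$ is a (minimum) $k$-power dominating set of $N[X]$ in $G$. In addition, if $\deg_G(u)\leq k$, then $\{u\}$ is also a (minimum) $k$-forcing set of $N[X]$ in $G$.
   Context: Graphs are finite, simple and undirected; $N[S]=\bigcup_{v\in S}(N(v)\cup\{v\})$. For a graph $G=(V,E)$, nonnegative integer $k$ and $A\subseteq V$: $\mathscr F^0_{G,k}(A)=A$, $\mathscr F^{i+1}_{G,k}(A)=\mathscr F^i_{G,k}(A)\cup\bigcup\{N(v): v\in \mathscr F^i_{G,k}(A),\ 1\le |N(v)\setminus \mathscr F^i_{G,k}(A)|\le k\}$; and $\mathscr P^0_{G,k}(A)=N[A]$ with $\mathscr P^{i+1}_{G,k}(A)$ defined from $\mathscr P^i_{G,k}(A)$ by the same rule. For $A\subseteq Y\subseteq V$, $A$ is a $k$-forcing set of $Y$ in $G$ if $Y\subseteq \mathscr F^t_{G,k}(A)$ for some $t$, and $A$ is a $k$-power dominating set of $Y$ in $G$ if $Y\subseteq \mathscr P^\ell_{G,k}(A)$ for some $\ell$. -}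

module Defs where

open import Data.Nat using (ℕ; zero; suc; _≤ᵇ_)
open import Data.Bool using (Bool; true; false; _∧_; _∨_; if_then_else_)
open import Data.Fin using (Fin)
open import Data.Fin.Subset using (Subset; inside; outside; _∈_; _⊆_; _─_; ∣_∣)
open import Data.Vec using (tabulate; lookup)
open import Data.Product using (∃)
open import Relation.Binary.PropositionalEquality using (_≡_)

record Graph (n : ℕ) : Set where
  field
    adj    : Fin n → Fin n → Bool
    sym    : ∀ u v → adj u v ≡ adj v u
    irrefl : ∀ v → adj v v ≡ false
open Graph public

anyFin : ∀ {n} → (Fin n → Bool) → Bool
anyFin {zero}  f = false
anyFin {suc n} f = f Fin.zero ∨ anyFin (λ i → f (Fin.suc i))

N : ∀ {n} → Graph n → Fin n → Subset n
N G v = tabulate (λ w → adj G v w)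

deg : ∀ {n} → Graph n → Fin n → ℕ
deg G v = ∣ N G v ∣

N[_]_ : ∀ {n} → Graph n → Subset n → Subset n
N[ G ] S = tabulate (λ w → lookup S w ∨ anyFin (λ v → lookup S v ∧ adj G v w))

canForce : ∀ {n} → Graph n → ℕ → Subset n → Fin n → Bool
canForce G k S v = (1 ≤ᵇ ∣ N G v ─ S ∣) ∧ (∣ N G v ─ S ∣ ≤ᵇ k)

forceStep : ∀ {n} → Graph n → ℕ → Subset n → Subset n
forceStep G k S =
  tabulate (λ w → lookup S w ∨ anyFin (λ v → lookup S v ∧ canForce G k S v ∧ adj G v w))

𝓕 : ∀ {n} → Graph n → ℕ → ℕ → Subset n → Subset n
𝓕 G k zero    A = A
𝓕 G k (suc i) A = forceStep G k (𝓕 G k i A)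

𝓟 : ∀ {n} → Graph n → ℕ → ℕ → Subset n → Subset n
𝓟 G k i A = 𝓕 G k i (N[ G ] A)

IsKForcingSetOf : ∀ {n} → Graph n → ℕ → Subset n → Subset n → Set
IsKForcingSetOf G k A Y = A ⊆ Y × ∃ (λ t → Y ⊆ 𝓕 G k t A)
  where open import Data.Product using (_×_)

IsKPowerDomSetOf : ∀ {n} → Graph n → ℕ → Subset n → Subset n → Set
IsKPowerDomSetOf G k A Y = A ⊆ Y × ∃ (λ l → Y ⊆ 𝓟 G k l A)
  where open import Data.Product using (_×_)

data WalkIn {n} (G : Graph n) (X : Subset n) : Fin n → Fin n → Set where
  here : ∀ {x} → x ∈ X → WalkIn G X x x
  step : ∀ {x y z} → x ∈ X → adj G x y ≡ true → WalkIn G X y z → WalkIn G X x z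

InducedConnected : ∀ {n} → Graph n → Subset n → Set
InducedConnected G X = ∀ {x y} → x ∈ X → y ∈ X → WalkIn G X x y

-- Call x saturated by S when N[x] ⊆ S. If some iterate of the forcing process
-- saturates x, the next one saturates every neighbour y of x in X: the coloured
-- x lies in N(y), so y has at most deg(y) - 1 ≤ k uncoloured neighbours and
-- forces them all. Walking through the connected G[X] from u, the process
-- eventually saturates all of X, i.e. covers N[X]. The power domination process
-- saturates u from the start (P⁰ = N[u]), and when deg(u) ≤ k one forcing step
-- from {u} does. Minimality: nothing is ever coloured from the empty set.
module Submission where

open import Defs
open import Data.Nat using (ℕ; suc; _≤_)
open import Data.Fin using (Fin)
open import Data.Fin.Subset using (Subset; _∈_; ⁅_⁆; ∣_∣)
open import Data.Product using (_×_)

open import Data.Bool using (Bool; T; _∧_)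
open import Data.Bool.Properties using (T-≡; T-∧; T-∨)
open import Data.Empty using (⊥-elim)
open import Data.Fin using (zero; suc)
open import Data.Fin.Subset using (_⊆_; _─_; Nonempty)
open import Data.Fin.Subset.Properties
  using (_∈?_; x∈⁅x⁆; x∈⁅y⁆⇒x≡y; ∣⁅x⁆∣≡1; ∣p∣≤∣x∷p∣; x∈p∩q⁺; x∈p∧x∉q⇒x∈p─q; ∣p─q∣≤∣p∣;
         p∩q≢∅⇒∣p─q∣<∣p∣)
open import Data.Nat using (zero; suc; _+_; _<_; z≤n; s≤s; _≤′_; ≤′-refl; ≤′-step)
open import Data.Nat.Properties using (≤-trans; ≤-pred; ≤⇒≤ᵇ; ≤⇒≤′; m≤m+n; m≤n+m)
open import Data.Product using (∃; _,_; proj₁; proj₂)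
import Data.Product as Product
open import Data.Sum using (_⊎_; inj₁; inj₂)
open import Data.Vec using (lookup; tabulate; here; there)
open import Data.Vec.Properties using ([]=⇒lookup; lookup⇒[]=; lookup∘tabulate)
open import Function using (_∘_; id)
open import Function.Bundles using (Equivalence)
open import Relation.Nullary using (Dec; yes; no)
open import Relation.Binary.PropositionalEquality using (subst) renaming (sym to ≡-sym)

open Equivalence using (to; from)

private
  variable
    n : ℕ
    x y w : Fin n
    p : Subset n

∈⇒T-lookup : x ∈ p → T (lookup p x)
∈⇒T-lookup = from T-≡ ∘ []=⇒lookup

T-lookup⇒∈ : T (lookup p x) → x ∈ p
T-lookup⇒∈ {p = p} {x = x} = lookup⇒[]= x p ∘ to T-≡

∈-tabulate⁺ : ∀ {f : Fin n → Bool} → T (f x) → x ∈ tabulate f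
∈-tabulate⁺ {x = x} {f = f} = T-lookup⇒∈ ∘ subst T (≡-sym (lookup∘tabulate f x))

∈-tabulate⁻ : ∀ {f : Fin n → Bool} → x ∈ tabulate f → T (f x)
∈-tabulate⁻ {x = x} {f = f} = subst T (lookup∘tabulate f x) ∘ ∈⇒T-lookup

anyFin⁺ : (f : Fin n → Bool) (v : Fin n) → T (f v) → T (anyFin f)
anyFin⁺ f zero    t = from T-∨ (inj₁ t)
anyFin⁺ f (suc v) t = from T-∨ (inj₂ (anyFin⁺ (f ∘ suc) v t))

anyFin⁻ : (f : Fin n → Bool) → T (anyFin f) → ∃ λ v → T (f v)
anyFin⁻ {zero}  f ()
anyFin⁻ {suc n} f t with to T-∨ t
... | inj₁ t₀ = zero , t₀
... | inj₂ t₊ = Product.map suc id (anyFin⁻ (f ∘ suc) t₊)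

x∈p⇒0<∣p∣ : x ∈ p → 0 < ∣ p ∣
x∈p⇒0<∣p∣ here                        = s≤s z≤n
x∈p⇒0<∣p∣ (there {y = b} {xs = p} x∈p) = ≤-trans (x∈p⇒0<∣p∣ x∈p) (∣p∣≤∣x∷p∣ b p)

monotone-∀∃⇒∃∀ : ∀ {m} (P : Fin m → ℕ → Set) → (∀ z {i j} → i ≤ j → P z i → P z j)
               → (∀ z → ∃ (P z)) → ∃ λ t → ∀ z → P z t
monotone-∀∃⇒∃∀ {zero}  P mono reach = 0 , λ ()
monotone-∀∃⇒∃∀ {suc m} P mono reach
  with t₀ , P₀ ← reach zero
     | t₊ , P₊ ← monotone-∀∃⇒∃∀ (P ∘ suc) (mono ∘ suc) (reach ∘ suc)
  = t₀ + t₊ , λ where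
      zero    → mono zero (m≤m+n t₀ t₊) P₀
      (suc z) → mono (suc z) (m≤n+m t₊ t₀) (P₊ z)

module _ (G : Graph n) where

  ∈N⁺ : T (adj G x y) → y ∈ N G x
  ∈N⁺ = ∈-tabulate⁺

  ∈N⁻ : y ∈ N G x → T (adj G x y)
  ∈N⁻ = ∈-tabulate⁻

  ∈N-sym : y ∈ N G x → x ∈ N G y
  ∈N-sym {y = y} {x = x} = ∈N⁺ ∘ subst T (Graph.sym G x y) ∘ ∈N⁻

  ⊆N[] : p ⊆ N[ G ] p
  ⊆N[] x∈p = ∈-tabulate⁺ (from T-∨ (inj₁ (∈⇒T-lookup x∈p)))

  N⊆N[] : x ∈ p → N G x ⊆ N[ G ] p
  N⊆N[] {x = x} x∈p w∈Nx =
    ∈-tabulate⁺ (from T-∨ (inj₂ (anyFin⁺ _ x (from T-∧ (∈⇒T-lookup x∈p , ∈N⁻ w∈Nx)))))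

  ∈N[]⁻ : w ∈ N[ G ] p → w ∈ p ⊎ ∃ λ x → x ∈ p × w ∈ N G x
  ∈N[]⁻ w∈N[p] with to T-∨ (∈-tabulate⁻ w∈N[p])
  ... | inj₁ w∈p = inj₁ (T-lookup⇒∈ w∈p)
  ... | inj₂ some with x , x~w ← anyFin⁻ _ some with x∈p , adj ← to T-∧ x~w
    = inj₂ (x , T-lookup⇒∈ x∈p , ∈N⁺ adj)

  N[]-Nonempty⁻ : Nonempty (N[ G ] p) → Nonempty p
  N[]-Nonempty⁻ (w , w∈N[p]) with ∈N[]⁻ w∈N[p]
  ... | inj₁ w∈p           = w , w∈p
  ... | inj₂ (x , x∈p , _) = x , x∈p

  Saturated : Subset n → Fin n → Set
  Saturated S x = x ∈ S × N G x ⊆ S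

  Saturated-⊆ : ∀ {S S′} → S ⊆ S′ → Saturated S x → Saturated S′ x
  Saturated-⊆ S⊆S′ (x∈S , Nx⊆S) = S⊆S′ x∈S , S⊆S′ ∘ Nx⊆S

  Saturated-N[] : x ∈ p → Saturated (N[ G ] p) x
  Saturated-N[] x∈p = ⊆N[] x∈p , N⊆N[] x∈p

  Saturated⇒N[]⊆ : ∀ {X S} → (∀ {x} → x ∈ X → Saturated S x) → N[ G ] X ⊆ S
  Saturated⇒N[]⊆ sat w∈N[X] with ∈N[]⁻ w∈N[X]
  ... | inj₁ w∈X               = proj₁ (sat w∈X)
  ... | inj₂ (x , x∈X , w∈Nx) = proj₂ (sat x∈X) w∈Nx

  module _ (k : ℕ) where

    ⊆forceStep : p ⊆ forceStep G k p
    ⊆forceStep x∈p = ∈-tabulate⁺ (from T-∨ (inj₁ (∈⇒T-lookup x∈p)))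

    forceStep⊆N[] : forceStep G k p ⊆ N[ G ] p
    forceStep⊆N[] {p = p} {x = w} w∈step with to (T-∨ {lookup p w}) (∈-tabulate⁻ w∈step)
    ... | inj₁ w∈p = ⊆N[] {p = p} (T-lookup⇒∈ w∈p)
    ... | inj₂ some
      with x , x→w ← anyFin⁻ (λ v → lookup p v ∧ canForce G k p v ∧ adj G v w) some
      with x∈p , forces ← to T-∧ x→w
      = N⊆N[] {p = p} (T-lookup⇒∈ x∈p) (∈N⁺ (proj₂ (to T-∧ forces)))

    N⊆forceStep : x ∈ p → 1 ≤ ∣ N G x ─ p ∣ → ∣ N G x ─ p ∣ ≤ k → N G x ⊆ forceStep G k p
    N⊆forceStep {x = x} x∈p some few w∈Nx =
      ∈-tabulate⁺ (from T-∨ (inj₂ (anyFin⁺ _ x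
        (from T-∧ (∈⇒T-lookup x∈p , from T-∧ (from T-∧ (≤⇒≤ᵇ some , ≤⇒≤ᵇ few) , ∈N⁻ w∈Nx))))))

    forceStep-saturates : x ∈ p → ∣ N G x ─ p ∣ ≤ k → Saturated (forceStep G k p) x
    forceStep-saturates {x = x} {p = p} x∈p few = ⊆forceStep x∈p , λ w∈Nx → absorb w∈Nx (_ ∈? p)
      where
      absorb : w ∈ N G x → Dec (w ∈ p) → w ∈ forceStep G k p
      absorb w∈Nx (yes w∈p) = ⊆forceStep w∈p
      absorb w∈Nx (no  w∉p) = N⊆forceStep x∈p (x∈p⇒0<∣p∣ (x∈p∧x∉q⇒x∈p─q w∈Nx w∉p)) few w∈Nx

    Saturated-spreads : ∀ {S} → Saturated S x → y ∈ N G x → deg G y ≤ suc k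
                      → Saturated (forceStep G k S) y
    Saturated-spreads {x = x} {y = y} {S = S} (x∈S , Nx⊆S) y∈Nx deg≤ =
      forceStep-saturates (Nx⊆S y∈Nx) (≤-pred (≤-trans missing<deg deg≤))
      where
      missing<deg : ∣ N G y ─ S ∣ < deg G y
      missing<deg = p∩q≢∅⇒∣p─q∣<∣p∣ (N G y) S (x , x∈p∩q⁺ (∈N-sym y∈Nx , x∈S))

    𝓕-mono : ∀ {i j A} → i ≤ j → 𝓕 G k i A ⊆ 𝓕 G k j A
    𝓕-mono = go ∘ ≤⇒≤′
      where
      go : ∀ {i j A} → i ≤′ j → 𝓕 G k i A ⊆ 𝓕 G k j A
      go ≤′-refl       = id
      go (≤′-step i≤j) = ⊆forceStep ∘ go i≤j

    𝓕-Nonempty⁻ : ∀ t {A} → Nonempty (𝓕 G k t A) → Nonempty A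
    𝓕-Nonempty⁻ zero    = id
    𝓕-Nonempty⁻ (suc t) {A} (w , w∈) =
      𝓕-Nonempty⁻ t (N[]-Nonempty⁻ (w , forceStep⊆N[] {p = 𝓕 G k t A} w∈))

    module _ {X : Subset n} (connected : InducedConnected G X)
             (bounded : ∀ x → x ∈ X → deg G x ≤ suc k) where

      private
        source∈ : ∀ {x z} → WalkIn G X x z → x ∈ X
        source∈ (here x∈X)     = x∈X
        source∈ (step x∈X _ _) = x∈X

      Saturated-along-walk : ∀ i A {x z} → Saturated (𝓕 G k i A) x → WalkIn G X x z
                           → ∃ λ j → Saturated (𝓕 G k j A) z
      Saturated-along-walk i A sat (here _)           = i , sat
      Saturated-along-walk i A sat (step _ x~y walk) =
        Saturated-along-walk (suc i) A
          (Saturated-spreads sat (∈N⁺ (from T-≡ x~y)) (bounded _ (source∈ walk))) walk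

      Saturated⇒N[]⊆𝓕 : ∀ {u} i A → u ∈ X → Saturated (𝓕 G k i A) u
                      → ∃ λ t → N[ G ] X ⊆ 𝓕 G k t A
      Saturated⇒N[]⊆𝓕 {u} i A u∈X sat =
        Product.map₂ (λ all → Saturated⇒N[]⊆ (λ {x} x∈X → all x x∈X))
          (monotone-∀∃⇒∃∀ P (λ z i≤j Pz z∈X → Saturated-⊆ (𝓕-mono i≤j) (Pz z∈X)) reach)
        where
        P : Fin n → ℕ → Set
        P z t = z ∈ X → Saturated (𝓕 G k t A) z
        reach : ∀ z → ∃ (P z)
        reach z with z ∈? X
        ... | yes z∈X = Product.map₂ (λ sat _ → sat) (Saturated-along-walk i A sat (connected u∈X z∈X))
        ... | no  z∉X = 0 , ⊥-elim ∘ z∉X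

lemma3p8 : ∀ {n} (G : Graph n) (k : ℕ) (X : Subset n)
    → InducedConnected G X
    → (∀ x → x ∈ X → deg G x ≤ suc k)
    → (u : Fin n) → u ∈ X
    → (IsKPowerDomSetOf G k ⁅ u ⁆ (N[ G ] X)
        × (∀ B → IsKPowerDomSetOf G k B (N[ G ] X) → ∣ ⁅ u ⁆ ∣ ≤ ∣ B ∣))
      × (deg G u ≤ k
        → IsKForcingSetOf G k ⁅ u ⁆ (N[ G ] X)
          × (∀ B → IsKForcingSetOf G k B (N[ G ] X) → ∣ ⁅ u ⁆ ∣ ≤ ∣ B ∣))
lemma3p8 G k X connected bounded u u∈X =
  ( (⁅u⁆⊆N[X] , covers (N[ G ] ⁅ u ⁆) 0 (Saturated-N[] G (x∈⁅x⁆ u)))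
  , λ B (_ , l , N[X]⊆) → minimal B (N[]-Nonempty⁻ G (𝓕-Nonempty⁻ G k l (u , N[X]⊆ u∈N[X]))) )
  , λ deg≤k →
    ( (⁅u⁆⊆N[X] , covers ⁅ u ⁆ 1 (saturated-after-one-step deg≤k))
    , λ B (_ , t , N[X]⊆) → minimal B (𝓕-Nonempty⁻ G k t (u , N[X]⊆ u∈N[X])) )
  where
  u∈N[X] : u ∈ N[ G ] X
  u∈N[X] = ⊆N[] G u∈X
  ⁅u⁆⊆N[X] : ⁅ u ⁆ ⊆ N[ G ] X
  ⁅u⁆⊆N[X] v∈⁅u⁆ = subst (_∈ N[ G ] X) (≡-sym (x∈⁅y⁆⇒x≡y u v∈⁅u⁆)) u∈N[X]
  saturated-after-one-step : deg G u ≤ k → Saturated G (𝓕 G k 1 ⁅ u ⁆) u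
  saturated-after-one-step deg≤k =
    forceStep-saturates G k (x∈⁅x⁆ u) (≤-trans (∣p─q∣≤∣p∣ (N G u) ⁅ u ⁆) deg≤k)
  covers : ∀ A i → Saturated G (𝓕 G k i A) u → ∃ λ t → N[ G ] X ⊆ 𝓕 G k t A
  covers A i = Saturated⇒N[]⊆𝓕 G k connected bounded i A u∈X
  minimal : ∀ B → Nonempty B → ∣ ⁅ u ⁆ ∣ ≤ ∣ B ∣
  minimal B (_ , v∈B) = subst (_≤ ∣ B ∣) (≡-sym (∣⁅x⁆∣≡1 u)) (x∈p⇒0<∣p∣ v∈B)
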